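{- The double diamond lattice is not isomorphic to any interval $[\mathbf{a},\mathbf{b}]$ of the Muchnik lattice $\mathcal{M}_w$. Here the double diamond lattice is the seven-element lattice $\{0,b,c,d,e,f,1\}$ with $0<b<d$, $0<c<d$, $d<e<1$, $d<f<1$, where $b,c$ are incomparable and $e,f$ are incomparable (two four-element Boolean algebras stacked on top of each other, sharing the element $d$).
   Context: Mass problems are subsets of Baire space $\omega^\omega$. For mass problems $\mathcal{A},\mathcal{B}$, Muchnik reducibility is $\mathcal{A}\le_w\mathcal{B}$ iff for every $f\in\mathcal{B}$ there is $g\in\mathcal{A}$ with $g\le_T f$; $\equiv_w$ is the induced equivalence. The Muchnik lattice $\mathcal{M}_w$ is the set of $\equiv_w$-classes ordered by $\le_w$. $[\mathbf{a},\mathbf{b}]=\{\mathbf{x}:\mathbf{a}\le_w\mathbf{x}\le_w\mathbf{b}\}$. -}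

module Defs where

open import Data.Nat using (ℕ; zero; suc; _<_)
open import Data.Fin using (Fin)
open import Data.Vec using (Vec; []; _∷_; lookup)
open import Data.Product using (Σ; _×_; ∃)
open import Relation.Unary using (Pred; _∈_)
open import Level using (0ℓ)

Baire : Set
Baire = ℕ → ℕ

MassProblem : Set₁
MassProblem = Pred Baire 0ℓ

-- Oracle partial recursive functions (Kleene's mu-recursive functions
-- relativised to an oracle f : ℕ → ℕ).  Code n = codes of n-ary functions.

data Code : ℕ → Set where
  zer  : ∀ {n} → Code n
  succ : Code 1
  proj : ∀ {n} → Fin n → Code n
  orc  : Code 1
  comp : ∀ {m n} → Code m → Vec (Code n) m → Code n
  prec : ∀ {n} → Code n → Code (suc (suc n)) → Code (suc n)
  mu   : ∀ {n} → Code (suc n) → Code n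

-- Big-step semantics: Eval f e xs y  means  e with oracle f on input xs
-- halts with output y.
mutual
  data Eval (f : Baire) : ∀ {n} → Code n → Vec ℕ n → ℕ → Set where
    ev-zer  : ∀ {n} {xs : Vec ℕ n} → Eval f zer xs 0
    ev-succ : ∀ {x} → Eval f succ (x ∷ []) (suc x)
    ev-proj : ∀ {n} {i : Fin n} {xs} → Eval f (proj i) xs (lookup xs i)
    ev-orc  : ∀ {x} → Eval f orc (x ∷ []) (f x)
    ev-comp : ∀ {m n} {g : Code m} {hs : Vec (Code n) m} {xs : Vec ℕ n}
                {ys : Vec ℕ m} {y} →
              EvalVec f hs xs ys → Eval f g ys y → Eval f (comp g hs) xs y
    ev-prec0 : ∀ {n} {g : Code n} {h : Code (suc (suc n))} {xs y} →
               Eval f g xs y → Eval f (prec g h) (0 ∷ xs) y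
    ev-precS : ∀ {n} {g : Code n} {h : Code (suc (suc n))} {xs k z y} →
               Eval f (prec g h) (k ∷ xs) z →
               Eval f h (k ∷ z ∷ xs) y →
               Eval f (prec g h) (suc k ∷ xs) y
    ev-mu   : ∀ {n} {g : Code (suc n)} {xs : Vec ℕ n} {k} →
              Eval f g (k ∷ xs) 0 →
              (∀ j → j < k → ∃ λ m → Eval f g (j ∷ xs) (suc m)) →
              Eval f (mu g) xs k

  data EvalVec (f : Baire) {n : ℕ} : ∀ {m} → Vec (Code n) m → Vec ℕ n → Vec ℕ m → Set where
    evv-[] : ∀ {xs} → EvalVec f [] xs []
    evv-∷  : ∀ {m} {h : Code n} {hs : Vec (Code n) m} {xs y ys} →
             Eval f h xs y → EvalVec f hs xs ys → EvalVec f (h ∷ hs) xs (y ∷ ys)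

_≤T_ : Baire → Baire → Set
g ≤T f = Σ (Code 1) λ e → ∀ n → Eval f e (n ∷ []) (g n)

_≤w_ : MassProblem → MassProblem → Set
A ≤w B = ∀ f → f ∈ B → Σ Baire λ g → g ∈ A × g ≤T f

_≡w_ : MassProblem → MassProblem → Set
A ≡w B = A ≤w B × B ≤w A

InInterval : MassProblem → MassProblem → MassProblem → Set
InInterval a b X = a ≤w X × X ≤w b

data DD : Set where
  d0 db dc dd de df d1 : DD

data _≤DD_ : DD → DD → Set where
  refl≤ : ∀ {x} → x ≤DD x
  0≤    : ∀ {x} → d0 ≤DD x
  ≤1    : ∀ {x} → x ≤DD d1
  b≤d   : db ≤DD dd
  b≤e   : db ≤DD de
  b≤f   : db ≤DD df
  c≤d   : dc ≤DD dd
  c≤e   : dc ≤DD de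
  c≤f   : dc ≤DD df
  d≤e   : dd ≤DD de
  d≤f   : dd ≤DD df

-- An (order = lattice) isomorphism from DD onto the interval [a , b] of
-- M_w, where elements of M_w are represented by mass problems up to ≡w:
-- φ lands in [a , b], reflects and preserves order, and every element of
-- [a , b] is ≡w to some φ x (surjectivity on degrees; injectivity on
-- degrees follows from order reflection).

record DDIsoInterval (a b : MassProblem) : Set₁ where
  field
    φ          : DD → MassProblem
    φ-in       : ∀ x → InInterval a b (φ x)
    φ-mono     : ∀ {x y} → x ≤DD y → φ x ≤w φ y
    φ-reflect  : ∀ {x y} → φ x ≤w φ y → x ≤DD y
    φ-onto     : ∀ X → InInterval a b X → Σ DD λ x → X ≡w φ x

{-# OPTIONS --safe #-}
-- Union of mass problems is the Muchnik meet. Given φ : DD ≅ [a , b], write ⟨r⟩ (deg⊓⊤ r) for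
-- {r} ∪ φ(1); it lies in the interval when r computes a member of a, and lies above φ(x)
-- whenever r computes a member of φ(x).
--
-- If no r ∈ φ(b) had ⟨r⟩ ≤w φ(b), then for each r ∈ φ(b) the element ⟨r⟩ would be φ(z) for some
-- z > b, hence z ≥ c, and r would compute a member of φ(c); so φ(c) ≤w φ(b), i.e. c ≤ b.
-- Hence φ(b) ≡w ⟨r⟩ and likewise φ(c) ≡w ⟨s⟩ for some r and s. For j = r ⊕ s, ⟨j⟩ is above
-- φ(b) and φ(c), and it is below φ(d) because every member of φ(d) computes r or a member of
-- φ(1), and s or a member of φ(1). So ⟨j⟩ ≡w φ(d) ≥w φ(e) ∪ φ(f), and j ∈ ⟨j⟩ computes a
-- member of φ(e) or of φ(f), which puts φ(e) or φ(f) below ⟨j⟩ ≡w φ(d): a contradiction.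
-- The choice of r and s is made by contradiction, which is harmless since the goal is ⊥.
module Submission where

open import Defs
open import Relation.Nullary using (¬_)
open import Relation.Unary using (｛_｝; _∪_)
open import Data.Nat using (ℕ; zero; suc; _+_)
open import Data.Fin using () renaming (zero to fz; suc to fs)
open import Data.Vec using (Vec; []; _∷_)
open import Data.Product using (Σ; _×_; _,_; proj₁; proj₂)
open import Data.Sum using (_⊎_; inj₁; inj₂)
open import Data.Empty using (⊥; ⊥-elim)
open import Relation.Binary.PropositionalEquality using (_≡_; refl; subst)

mutual
  substOracle : ∀ {n} → Code 1 → Code n → Code n
  substOracle e zer         = zer
  substOracle e succ        = succ
  substOracle e (proj i)    = proj i
  substOracle e orc         = e
  substOracle e (comp g hs) = comp (substOracle e g) (substOracleVec e hs)
  substOracle e (prec g h)  = prec (substOracle e g) (substOracle e h)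
  substOracle e (mu g)      = mu (substOracle e g)

  substOracleVec : ∀ {n m} → Code 1 → Vec (Code n) m → Vec (Code n) m
  substOracleVec e []       = []
  substOracleVec e (h ∷ hs) = substOracle e h ∷ substOracleVec e hs

module _ {f h : Baire} (e : Code 1) (e-computes-f : ∀ n → Eval h e (n ∷ []) (f n)) where
  mutual
    Eval-substOracle : ∀ {n} {c : Code n} {xs y} → Eval f c xs y → Eval h (substOracle e c) xs y
    Eval-substOracle ev-zer          = ev-zer
    Eval-substOracle ev-succ         = ev-succ
    Eval-substOracle ev-proj         = ev-proj
    Eval-substOracle (ev-orc {x})    = e-computes-f x
    Eval-substOracle (ev-comp hs g)  = ev-comp (EvalVec-substOracle hs) (Eval-substOracle g)
    Eval-substOracle (ev-prec0 g)    = ev-prec0 (Eval-substOracle g)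
    Eval-substOracle (ev-precS p q)  = ev-precS (Eval-substOracle p) (Eval-substOracle q)
    Eval-substOracle (ev-mu zero-at below) =
      ev-mu (Eval-substOracle zero-at)
            (λ j j<k → proj₁ (below j j<k) , Eval-substOracle (proj₂ (below j j<k)))

    EvalVec-substOracle : ∀ {n m} {hs : Vec (Code n) m} {xs ys} →
                          EvalVec f hs xs ys → EvalVec h (substOracleVec e hs) xs ys
    EvalVec-substOracle evv-[]       = evv-[]
    EvalVec-substOracle (evv-∷ p ps) = evv-∷ (Eval-substOracle p) (EvalVec-substOracle ps)

≤T-refl : ∀ f → f ≤T f
≤T-refl f = orc , λ n → ev-orc

≤T-trans : ∀ {g f h} → g ≤T f → f ≤T h → g ≤T h
≤T-trans (c , c-computes-g) (e , e-computes-f) =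
  substOracle e c , λ n → Eval-substOracle e e-computes-f (c-computes-g n)

isZero : ℕ → ℕ
isZero zero    = 1
isZero (suc _) = 0

parity : ℕ → ℕ
parity zero    = 0
parity (suc n) = isZero (parity n)

half : ℕ → ℕ
half zero    = 0
half (suc n) = parity n + half n

double : ℕ → ℕ
double zero    = 0
double (suc n) = suc (suc (double n))

ifZero : ℕ → ℕ → ℕ → ℕ
ifZero zero    x y = x
ifZero (suc _) x y = y

parity-double : ∀ n → parity (double n) ≡ 0
parity-double zero = refl
parity-double (suc n) rewrite parity-double n = refl

half-double : ∀ n → half (double n) ≡ n
half-double zero = refl
half-double (suc n) rewrite parity-double n | half-double n = refl

isZeroᶜ : Code 1
isZeroᶜ = prec (comp succ (zer ∷ [])) zer

parityᶜ : Code 1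
parityᶜ = prec zer (comp isZeroᶜ (proj (fs fz) ∷ []))

addᶜ : Code 2
addᶜ = prec (proj fz) (comp succ (proj (fs fz) ∷ []))

halfᶜ : Code 1
halfᶜ = prec zer (comp addᶜ (comp parityᶜ (proj fz ∷ []) ∷ proj (fs fz) ∷ []))

doubleᶜ : Code 1
doubleᶜ = prec zer (comp succ (comp succ (proj (fs fz) ∷ []) ∷ []))

ifZeroᶜ : Code 3
ifZeroᶜ = prec (proj fz) (proj (fs (fs (fs fz))))

module _ {f : Baire} where
  Eval-isZeroᶜ : ∀ n → Eval f isZeroᶜ (n ∷ []) (isZero n)
  Eval-isZeroᶜ zero    = ev-prec0 (ev-comp (evv-∷ ev-zer evv-[]) ev-succ)
  Eval-isZeroᶜ (suc n) = ev-precS (Eval-isZeroᶜ n) ev-zer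

  Eval-parityᶜ : ∀ n → Eval f parityᶜ (n ∷ []) (parity n)
  Eval-parityᶜ zero    = ev-prec0 ev-zer
  Eval-parityᶜ (suc n) =
    ev-precS (Eval-parityᶜ n) (ev-comp (evv-∷ ev-proj evv-[]) (Eval-isZeroᶜ _))

  Eval-addᶜ : ∀ x y → Eval f addᶜ (x ∷ y ∷ []) (x + y)
  Eval-addᶜ zero    y = ev-prec0 ev-proj
  Eval-addᶜ (suc x) y = ev-precS (Eval-addᶜ x y) (ev-comp (evv-∷ ev-proj evv-[]) ev-succ)

  Eval-halfᶜ : ∀ n → Eval f halfᶜ (n ∷ []) (half n)
  Eval-halfᶜ zero    = ev-prec0 ev-zer
  Eval-halfᶜ (suc n) =
    ev-precS (Eval-halfᶜ n)
      (ev-comp (evv-∷ (ev-comp (evv-∷ ev-proj evv-[]) (Eval-parityᶜ n)) (evv-∷ ev-proj evv-[]))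
               (Eval-addᶜ (parity n) (half n)))

  Eval-doubleᶜ : ∀ n → Eval f doubleᶜ (n ∷ []) (double n)
  Eval-doubleᶜ zero    = ev-prec0 ev-zer
  Eval-doubleᶜ (suc n) =
    ev-precS (Eval-doubleᶜ n)
      (ev-comp (evv-∷ (ev-comp (evv-∷ ev-proj evv-[]) ev-succ) evv-[]) ev-succ)

  Eval-ifZeroᶜ : ∀ p x y → Eval f ifZeroᶜ (p ∷ x ∷ y ∷ []) (ifZero p x y)
  Eval-ifZeroᶜ zero    x y = ev-prec0 ev-proj
  Eval-ifZeroᶜ (suc p) x y = ev-precS (Eval-ifZeroᶜ p x y) ev-proj

_⊕_ : Baire → Baire → Baire
(r ⊕ s) n = ifZero (parity n) (r (half n)) (s (half n))

⊕-even : ∀ r s n → (r ⊕ s) (double n) ≡ r n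
⊕-even r s n rewrite parity-double n | half-double n = refl

⊕-odd : ∀ r s n → (r ⊕ s) (suc (double n)) ≡ s n
⊕-odd r s n rewrite parity-double n | half-double n = refl

≤T-⊕ˡ : ∀ r s → r ≤T (r ⊕ s)
≤T-⊕ˡ r s = comp orc (doubleᶜ ∷ []) , λ n →
  subst (Eval (r ⊕ s) _ (n ∷ [])) (⊕-even r s n)
    (ev-comp (evv-∷ (Eval-doubleᶜ n) evv-[]) ev-orc)

≤T-⊕ʳ : ∀ r s → s ≤T (r ⊕ s)
≤T-⊕ʳ r s = comp orc (comp succ (doubleᶜ ∷ []) ∷ []) , λ n →
  subst (Eval (r ⊕ s) _ (n ∷ [])) (⊕-odd r s n)
    (ev-comp (evv-∷ (ev-comp (evv-∷ (Eval-doubleᶜ n) evv-[]) ev-succ) evv-[]) ev-orc)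

⊕-least : ∀ {r s h} → r ≤T h → s ≤T h → (r ⊕ s) ≤T h
⊕-least (er , er-computes-r) (es , es-computes-s) =
  comp ifZeroᶜ (parityᶜ ∷ comp er (halfᶜ ∷ []) ∷ comp es (halfᶜ ∷ []) ∷ []) , λ n →
  ev-comp (evv-∷ (Eval-parityᶜ n)
          (evv-∷ (ev-comp (evv-∷ (Eval-halfᶜ n) evv-[]) (er-computes-r (half n)))
          (evv-∷ (ev-comp (evv-∷ (Eval-halfᶜ n) evv-[]) (es-computes-s (half n))) evv-[])))
    (Eval-ifZeroᶜ _ _ _)

Computes : MassProblem → Baire → Set
Computes A f = Σ Baire λ g → A g × g ≤T f

Computes-≤T : ∀ {A f h} → Computes A f → f ≤T h → Computes A h
Computes-≤T (g , g∈A , g≤f) f≤h = g , g∈A , ≤T-trans g≤f f≤h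

≤w-trans : ∀ {A B C} → A ≤w B → B ≤w C → A ≤w C
≤w-trans A≤B B≤C f f∈C with B≤C f f∈C
... | g , g∈B , g≤f = Computes-≤T (A≤B g g∈B) g≤f

≤w-｛｝ : ∀ {A r} → Computes A r → A ≤w ｛ r ｝
≤w-｛｝ r-computes-A _ refl = r-computes-A

∪-lowerˡ : ∀ {A B} → (A ∪ B) ≤w A
∪-lowerˡ f f∈A = f , inj₁ f∈A , ≤T-refl f

∪-lowerʳ : ∀ {A B} → (A ∪ B) ≤w B
∪-lowerʳ f f∈B = f , inj₂ f∈B , ≤T-refl f

∪-greatest : ∀ {A B C} → C ≤w A → C ≤w B → C ≤w (A ∪ B)
∪-greatest C≤A C≤B f (inj₁ f∈A) = C≤A f f∈A
∪-greatest C≤A C≤B f (inj₂ f∈B) = C≤B f f∈B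

∪-inInterval : ∀ {a b A B} → a ≤w A → InInterval a b B → InInterval a b (A ∪ B)
∪-inInterval a≤A (a≤B , B≤b) = ∪-greatest a≤A a≤B , ≤w-trans ∪-lowerʳ B≤b

｛⊕｝-∪-≤w : ∀ {r s C D} → (｛ r ｝ ∪ C) ≤w D → (｛ s ｝ ∪ C) ≤w D → (｛ r ⊕ s ｝ ∪ C) ≤w D
｛⊕｝-∪-≤w r∪C≤D s∪C≤D h h∈D with r∪C≤D h h∈D | s∪C≤D h h∈D
... | u , inj₂ u∈C , u≤h | _                        = u , inj₂ u∈C , u≤h
... | _                  | v , inj₂ v∈C , v≤h       = v , inj₂ v∈C , v≤h
... | _ , inj₁ refl , r≤h | _ , inj₁ refl , s≤h     = _ , inj₁ refl , ⊕-least r≤h s≤h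

db≤z⇒z≡db⊎dc≤z : ∀ z → db ≤DD z → z ≡ db ⊎ dc ≤DD z
db≤z⇒z≡db⊎dc≤z .db refl≤ = inj₁ refl
db≤z⇒z≡db⊎dc≤z .d1 ≤1    = inj₂ ≤1
db≤z⇒z≡db⊎dc≤z .dd b≤d   = inj₂ c≤d
db≤z⇒z≡db⊎dc≤z .de b≤e   = inj₂ c≤e
db≤z⇒z≡db⊎dc≤z .df b≤f   = inj₂ c≤f

dc≤z⇒z≡dc⊎db≤z : ∀ z → dc ≤DD z → z ≡ dc ⊎ db ≤DD z
dc≤z⇒z≡dc⊎db≤z .dc refl≤ = inj₁ refl
dc≤z⇒z≡dc⊎db≤z .d1 ≤1    = inj₂ ≤1
dc≤z⇒z≡dc⊎db≤z .dd c≤d   = inj₂ b≤d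
dc≤z⇒z≡dc⊎db≤z .de c≤e   = inj₂ b≤e
dc≤z⇒z≡dc⊎db≤z .df c≤f   = inj₂ b≤f

dd-lub : ∀ {x} → db ≤DD x → dc ≤DD x → dd ≤DD x
dd-lub ≤1  _ = ≤1
dd-lub b≤d _ = refl≤
dd-lub b≤e _ = d≤e
dd-lub b≤f _ = d≤f

dd-glb : ∀ {x} → x ≤DD de → x ≤DD df → x ≤DD dd
dd-glb 0≤  _ = 0≤
dd-glb b≤e _ = b≤d
dd-glb c≤e _ = c≤d
dd-glb d≤e _ = refl≤

de≰dd : ¬ de ≤DD dd
de≰dd ()

df≰dd : ¬ df ≤DD dd
df≰dd ()

module _ {a b : MassProblem} (iso : DDIsoInterval a b) where
  open DDIsoInterval iso

  φdd-lub : ∀ {X} → InInterval a b X → φ db ≤w X → φ dc ≤w X → φ dd ≤w X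
  φdd-lub X-in φdb≤X φdc≤X with φ-onto _ X-in
  ... | x , X≤φx , φx≤X =
    ≤w-trans (φ-mono (dd-lub (φ-reflect (≤w-trans φdb≤X X≤φx)) (φ-reflect (≤w-trans φdc≤X X≤φx))))
             φx≤X

  φdd-glb : ∀ {X} → InInterval a b X → X ≤w φ de → X ≤w φ df → X ≤w φ dd
  φdd-glb X-in X≤φde X≤φdf with φ-onto _ X-in
  ... | x , X≤φx , φx≤X =
    ≤w-trans X≤φx (φ-mono (dd-glb (φ-reflect (≤w-trans φx≤X X≤φde)) (φ-reflect (≤w-trans φx≤X X≤φdf))))

  deg⊓⊤ : Baire → MassProblem
  deg⊓⊤ r = ｛ r ｝ ∪ φ d1

  deg⊓⊤-inInterval : ∀ {r} → Computes a r → InInterval a b (deg⊓⊤ r)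
  deg⊓⊤-inInterval r-computes-a = ∪-inInterval (≤w-｛｝ r-computes-a) (φ-in d1)

  φ≤w-deg⊓⊤ : ∀ {r} x → Computes (φ x) r → φ x ≤w deg⊓⊤ r
  φ≤w-deg⊓⊤ x r-computes-φx = ∪-greatest (≤w-｛｝ r-computes-φx) (φ-mono ≤1)

  Principal : DD → Set
  Principal x = Σ Baire λ r → φ x r × deg⊓⊤ r ≤w φ x

  ¬¬principal : ∀ x y → (∀ z → x ≤DD z → z ≡ x ⊎ y ≤DD z) → ¬ y ≤DD x → ¬ ¬ Principal x
  ¬¬principal x y above-x y≰x ¬principal = y≰x (φ-reflect φy≤φx)
    where
      φy≤φx : φ y ≤w φ x
      φy≤φx r r∈φx with φ-onto (deg⊓⊤ r) (deg⊓⊤-inInterval (proj₁ (φ-in x) r r∈φx))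
      ... | z , ⟨r⟩≤φz , φz≤⟨r⟩
        with above-x z (φ-reflect (≤w-trans (φ≤w-deg⊓⊤ x (r , r∈φx , ≤T-refl r)) ⟨r⟩≤φz))
      ... | inj₁ refl = ⊥-elim (¬principal (r , r∈φx , ⟨r⟩≤φz))
      ... | inj₂ y≤z  = ≤w-trans (φ-mono y≤z) φz≤⟨r⟩ r (inj₁ refl)

  φde∪φdf≤w-φdd : (φ de ∪ φ df) ≤w φ dd
  φde∪φdf≤w-φdd = φdd-glb (∪-inInterval (proj₁ (φ-in de)) (φ-in df)) ∪-lowerˡ ∪-lowerʳ

  ¬φdd≡w-deg⊓⊤ : ∀ j → φ dd ≤w deg⊓⊤ j → deg⊓⊤ j ≤w φ dd → ⊥
  ¬φdd≡w-deg⊓⊤ j φdd≤⟨j⟩ ⟨j⟩≤φdd with ≤w-trans φde∪φdf≤w-φdd φdd≤⟨j⟩ j (inj₁ refl)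
  ... | g , inj₁ g∈φde , g≤j = de≰dd (φ-reflect (≤w-trans (φ≤w-deg⊓⊤ de (g , g∈φde , g≤j)) ⟨j⟩≤φdd))
  ... | g , inj₂ g∈φdf , g≤j = df≰dd (φ-reflect (≤w-trans (φ≤w-deg⊓⊤ df (g , g∈φdf , g≤j)) ⟨j⟩≤φdd))

  ¬principal-db×dc : Principal db → Principal dc → ⊥
  ¬principal-db×dc (r , r∈φdb , ⟨r⟩≤φdb) (s , s∈φdc , ⟨s⟩≤φdc) =
    ¬φdd≡w-deg⊓⊤ (r ⊕ s) φdd≤⟨r⊕s⟩ ⟨r⊕s⟩≤φdd
    where
      φdd≤⟨r⊕s⟩ : φ dd ≤w deg⊓⊤ (r ⊕ s)
      φdd≤⟨r⊕s⟩ = φdd-lub (deg⊓⊤-inInterval (Computes-≤T (proj₁ (φ-in db) r r∈φdb) (≤T-⊕ˡ r s)))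
                          (φ≤w-deg⊓⊤ db (r , r∈φdb , ≤T-⊕ˡ r s))
                          (φ≤w-deg⊓⊤ dc (s , s∈φdc , ≤T-⊕ʳ r s))

      ⟨r⊕s⟩≤φdd : deg⊓⊤ (r ⊕ s) ≤w φ dd
      ⟨r⊕s⟩≤φdd = ｛⊕｝-∪-≤w (≤w-trans ⟨r⟩≤φdb (φ-mono b≤d)) (≤w-trans ⟨s⟩≤φdc (φ-mono c≤d))

proposition3p4 : (a b : MassProblem) → ¬ DDIsoInterval a b
proposition3p4 a b iso =
  ¬¬principal iso db dc db≤z⇒z≡db⊎dc≤z (λ ()) λ principal-db →
  ¬¬principal iso dc db dc≤z⇒z≡dc⊎db≤z (λ ()) λ principal-dc →
  ¬principal-db×dc iso principal-db principal-dc
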